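{- Let $G$ be a $\Delta$-regular graph of order $n$ with $\Delta\ge 3$. Then $$L_2(G)\ \ge\ \frac{2n}{\Delta^2-\Delta+2}.$$
   Context: All graphs are finite, simple and undirected. For a vertex $v$, $N[v]$ denotes the closed neighbourhood of $v$. A vertex set $X\subseteq V(G)$ is a $k$-limited packing if $|N[v]\cap X|\le k$ for every $v\in V(G)$; $L_k(G)$ is the maximum size of a $k$-limited packing in $G$. -}

module Defs where

open import Data.Nat using (ℕ; _≤_)
open import Data.Bool using (Bool; true; false; _∨_)
open import Data.Fin using (Fin; _≟_)
open import Data.Fin.Subset using (Subset; ∣_∣; _∩_)
open import Data.Vec using (tabulate)
open import Relation.Nullary.Decidable using (⌊_⌋)
open import Relation.Binary.PropositionalEquality using (_≡_)

record Graph (n : ℕ) : Set where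
  field
    adj   : Fin n → Fin n → Bool
    sym   : ∀ u v → adj u v ≡ adj v u
    irrefl : ∀ v → adj v v ≡ false
open Graph public

N : ∀ {n} → Graph n → Fin n → Subset n
N G v = tabulate (λ u → adj G v u)

N[_] : ∀ {n} → Graph n → Fin n → Subset n
N[ G ] v = tabulate (λ u → ⌊ u ≟ v ⌋ ∨ adj G v u)

degree : ∀ {n} → Graph n → Fin n → ℕ
degree G v = ∣ N G v ∣

Regular : ∀ {n} → Graph n → ℕ → Set
Regular G Δ = ∀ v → degree G v ≡ Δ

IsLimitedPacking : ∀ {n} → ℕ → Graph n → Subset n → Set
IsLimitedPacking k G X = ∀ v → ∣ N[ G ] v ∩ X ∣ ≤ k

-- Take a maximal 2-limited packing X and call v saturated when |N[v] ∩ X| = 2. By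
-- maximality every u ∉ X lies in N[v] for some saturated v, and the two vertices of X in
-- N[v] each pay one unit to u, so every vertex outside X receives at least 2. A vertex
-- x ∈ X pays the vertices outside X in N[v] for each saturated neighbour v, at most
-- Δ(Δ − 1) in total. A saturated x pays N[x] ∖ X itself and then only N(v) ∖ X for its
-- saturated neighbours v; as x has exactly one neighbour in X this is again at most
-- (Δ − 1) + Δ(Δ − 2) + 1 = Δ(Δ − 1). Hence 2(n − |X|) ≤ Δ(Δ − 1)|X|.
module Submission where

open import Defs renaming (sym to adj-sym)
open import Data.Nat.Properties hiding (_≟_)
open import Algebra.Properties.Semiring.Sum +-*-semiring
  using (sum; sum-cong-≗; sum-replicate-zero; ∑-distrib-+; ∑-comm; *-distribˡ-sum; *-distribʳ-sum)
open import Data.Bool as Bool using (Bool; true; false; _∧_; _∨_; not)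
open import Data.Fin using (Fin; zero; suc; _≟_)
open import Data.Fin.Properties using (any?; all?; ¬∀⟶∃¬)
open import Data.Fin.Subset using (Subset; ∣_∣; _∩_)
open import Data.Fin.Subset.Properties using (∣p∣≤n)
open import Data.Nat as ℕ using (ℕ; zero; suc; _+_; _*_; _∸_; _≤_; z≤n; s≤s; _≤?_)
open import Data.Nat.Tactic.RingSolver using (solve-∀)
open import Data.Product using (Σ; _×_; _,_; ∃-syntax)
open import Data.Sum using (_⊎_; inj₁; inj₂)
open import Data.Vec using (tabulate; _∷_)
open import Data.Vec.Functional using (Vector)
open import Function using (_∘_)
open import Relation.Nullary using (¬_; Dec; yes; no; contradiction)
open import Relation.Nullary.Decidable using (⌊_⌋; _×-dec_)
open import Relation.Binary.PropositionalEquality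

sum-mono-≤ : ∀ {n} {f g : Vector ℕ n} → (∀ i → f i ≤ g i) → sum f ≤ sum g
sum-mono-≤ {zero}  f≤g = z≤n
sum-mono-≤ {suc n} f≤g = +-mono-≤ (f≤g zero) (sum-mono-≤ (f≤g ∘ suc))

term≤sum : ∀ {n} (f : Vector ℕ n) i → f i ≤ sum f
term≤sum f zero    = m≤m+n (f zero) _
term≤sum f (suc i) = ≤-trans (term≤sum (f ∘ suc) i) (m≤n+m _ (f zero))

sum-const-1 : ∀ n → sum {n} (λ _ → 1) ≡ n
sum-const-1 zero    = refl
sum-const-1 (suc n) = cong suc (sum-const-1 n)

∑-*-comm : ∀ {m n} (g : Vector ℕ m) (h : Fin m → Fin n → ℕ) (w : Vector ℕ n) →
  sum (λ u → sum (λ v → g v * h v u) * w u) ≡ sum (λ v → g v * sum (λ u → h v u * w u))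
∑-*-comm g h w = begin
  sum (λ u → sum (λ v → g v * h v u) * w u)  ≡⟨ sum-cong-≗ (λ u → *-distribʳ-sum (w u) (λ v → g v * h v u)) ⟩
  sum (λ u → sum (λ v → g v * h v u * w u))  ≡⟨ ∑-comm (λ u v → g v * h v u * w u) ⟩
  sum (λ v → sum (λ u → g v * h v u * w u))  ≡⟨ sum-cong-≗ (λ v → pull-out v) ⟩
  sum (λ v → g v * sum (λ u → h v u * w u))  ∎
  where
  open ≡-Reasoning
  pull-out : ∀ v → sum (λ u → g v * h v u * w u) ≡ g v * sum (λ u → h v u * w u)
  pull-out v = trans (sum-cong-≗ (λ u → *-assoc (g v) (h v u) (w u)))
                     (sym (*-distribˡ-sum (g v) (λ u → h v u * w u)))

𝟙 : Bool → ℕ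
𝟙 true  = 1
𝟙 false = 0

𝟙≤1 : ∀ b → 𝟙 b ≤ 1
𝟙≤1 true  = s≤s z≤n
𝟙≤1 false = z≤n

𝟙-∧ : ∀ a b → 𝟙 (a ∧ b) ≡ 𝟙 a * 𝟙 b
𝟙-∧ true  b = sym (+-identityʳ (𝟙 b))
𝟙-∧ false b = refl

𝟙+𝟙-not : ∀ b → 𝟙 b + 𝟙 (not b) ≡ 1
𝟙+𝟙-not true  = refl
𝟙+𝟙-not false = refl

∣tabulate∣≡sum : ∀ {n} (f : Fin n → Bool) → ∣ tabulate f ∣ ≡ sum (𝟙 ∘ f)
∣tabulate∣≡sum {zero}  f = refl
∣tabulate∣≡sum {suc n} f with f zero
... | true  = cong suc (∣tabulate∣≡sum (f ∘ suc))
... | false = ∣tabulate∣≡sum (f ∘ suc)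

tabulate-∩ : ∀ {n} (f g : Fin n → Bool) → tabulate f ∩ tabulate g ≡ tabulate (λ i → f i ∧ g i)
tabulate-∩ {zero}  f g = refl
tabulate-∩ {suc n} f g = cong (f zero ∧ g zero ∷_) (tabulate-∩ (f ∘ suc) (g ∘ suc))

δ : ∀ {n} → Fin n → Fin n → ℕ
δ i j = 𝟙 ⌊ i ≟ j ⌋

δ-suc : ∀ {n} (i j : Fin n) → δ (suc i) (suc j) ≡ δ i j
δ-suc i j with i ≟ j
... | yes _ = refl
... | no  _ = refl

sum-δ : ∀ {n} (f : Vector ℕ n) j → sum (λ i → δ i j * f i) ≡ f j
sum-δ {suc n} f zero    = trans (cong₂ _+_ (+-identityʳ (f zero)) (sum-replicate-zero n)) (+-identityʳ (f zero))
sum-δ {suc n} f (suc j) = trans (sum-cong-≗ (λ i → cong (_* f (suc i)) (δ-suc i j))) (sum-δ (f ∘ suc) j)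

≤1⇒≤ : ∀ {c m} → c ≤ 1 → (c ≡ 1 → 1 ≤ m) → c ≤ m
≤1⇒≤ z≤n       _     = z≤n
≤1⇒≤ (s≤s z≤n) 1≤m   = 1≤m refl

overflow : ∀ {l k} c → c ≤ 1 → l ≤ k → ¬ l + c ≤ k → c ≡ 1 × l ≡ k
overflow {l} {k} zero    _ l≤k l+0≰k = contradiction (subst (_≤ k) (sym (+-identityʳ l)) l≤k) l+0≰k
overflow {l} {k} (suc zero) _ l≤k l+1≰k =
  refl , ≤-antisym l≤k (m<1+n⇒m≤n (subst (k ℕ.<_) (+-comm l 1) (≰⇒> l+1≰k)))
overflow (suc (suc c)) (s≤s ()) _ _

module _ {n} (G : Graph n) where

  A : Fin n → Fin n → ℕ
  A v u = 𝟙 (adj G v u)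

  C : Fin n → Fin n → ℕ
  C v u = 𝟙 (⌊ u ≟ v ⌋ ∨ adj G v u)

  C≤1 : ∀ v u → C v u ≤ 1
  C≤1 v u = 𝟙≤1 _

  A-sym : ∀ v u → A v u ≡ A u v
  A-sym v u = cong 𝟙 (adj-sym G v u)

  C-split : ∀ v u → C v u ≡ δ u v + A v u
  C-split v u with u ≟ v
  ... | yes refl rewrite irrefl G u = refl
  ... | no  _    = refl

  A≤C : ∀ v u → A v u ≤ C v u
  A≤C v u = subst (A v u ≤_) (sym (C-split v u)) (m≤n+m (A v u) (δ u v))

  C≡1⇒≡⊎A≡1 : ∀ {v u} → C v u ≡ 1 → u ≡ v ⊎ A v u ≡ 1
  C≡1⇒≡⊎A≡1 {v} {u} Cvu≡1 with u ≟ v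
  ... | yes u≡v = inj₁ u≡v
  ... | no  _   = inj₂ Cvu≡1

  sum-C : ∀ v (f : Vector ℕ n) → sum (λ u → C v u * f u) ≡ f v + sum (λ u → A v u * f u)
  sum-C v f = begin
    sum (λ u → C v u * f u)                         ≡⟨ sum-cong-≗ (λ u → cong (_* f u) (C-split v u)) ⟩
    sum (λ u → (δ u v + A v u) * f u)               ≡⟨ sum-cong-≗ (λ u → *-distribʳ-+ (f u) (δ u v) (A v u)) ⟩
    sum (λ u → δ u v * f u + A v u * f u)           ≡⟨ ∑-distrib-+ (λ u → δ u v * f u) (λ u → A v u * f u) ⟩
    sum (λ u → δ u v * f u) + sum (λ u → A v u * f u) ≡⟨ cong (_+ sum (λ u → A v u * f u)) (sum-δ f v) ⟩
    f v + sum (λ u → A v u * f u)                   ∎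
    where open ≡-Reasoning

  load : (Fin n → Bool) → Fin n → ℕ
  load X v = sum (λ u → C v u * 𝟙 (X u))

  ∣N[v]∩X∣≡load : ∀ X v → ∣ N[ G ] v ∩ tabulate X ∣ ≡ load X v
  ∣N[v]∩X∣≡load X v = begin
    ∣ N[ G ] v ∩ tabulate X ∣                              ≡⟨ cong ∣_∣ (tabulate-∩ _ X) ⟩
    ∣ tabulate (λ u → (⌊ u ≟ v ⌋ ∨ adj G v u) ∧ X u) ∣     ≡⟨ ∣tabulate∣≡sum (λ u → (⌊ u ≟ v ⌋ ∨ adj G v u) ∧ X u) ⟩
    sum (λ u → 𝟙 ((⌊ u ≟ v ⌋ ∨ adj G v u) ∧ X u))           ≡⟨ sum-cong-≗ (λ u → 𝟙-∧ _ (X u)) ⟩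
    load X v                                                ∎
    where open ≡-Reasoning

  size : (Fin n → Bool) → ℕ
  size X = sum (𝟙 ∘ X)

  size≤n : ∀ X → size X ≤ n
  size≤n X = subst (_≤ n) (∣tabulate∣≡sum X) (∣p∣≤n (tabulate X))

  Packing : ℕ → (Fin n → Bool) → Set
  Packing k X = ∀ v → load X v ≤ k

  packing? : ∀ k X → Dec (Packing k X)
  packing? k X = all? (λ v → load X v ≤? k)

  insert : (Fin n → Bool) → Fin n → Fin n → Bool
  insert X u w = X w ∨ ⌊ w ≟ u ⌋

  Maximal : ℕ → (Fin n → Bool) → Set
  Maximal k X = ∀ u → X u ≡ false → ¬ Packing k (insert X u)

  𝟙-insert : ∀ {X u} → X u ≡ false → ∀ w → 𝟙 (insert X u w) ≡ 𝟙 (X w) + δ w u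
  𝟙-insert {X} {u} Xu≡false w with w ≟ u
  ... | yes refl rewrite Xu≡false = refl
  ... | no  _    with X w
  ...   | true  = refl
  ...   | false = refl

  sum-insert : ∀ {X u} → X u ≡ false → ∀ (f : Vector ℕ n) →
    sum (λ w → f w * 𝟙 (insert X u w)) ≡ sum (λ w → f w * 𝟙 (X w)) + f u
  sum-insert {X} {u} Xu≡false f = begin
    sum (λ w → f w * 𝟙 (insert X u w))                   ≡⟨ sum-cong-≗ split ⟩
    sum (λ w → f w * 𝟙 (X w) + δ w u * f w)              ≡⟨ ∑-distrib-+ (λ w → f w * 𝟙 (X w)) (λ w → δ w u * f w) ⟩
    sum (λ w → f w * 𝟙 (X w)) + sum (λ w → δ w u * f w)  ≡⟨ cong (_ +_) (sum-δ f u) ⟩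
    sum (λ w → f w * 𝟙 (X w)) + f u                      ∎
    where
    open ≡-Reasoning
    split : ∀ w → f w * 𝟙 (insert X u w) ≡ f w * 𝟙 (X w) + δ w u * f w
    split w = trans (cong (f w *_) (𝟙-insert Xu≡false w))
                    (trans (*-distribˡ-+ (f w) (𝟙 (X w)) (δ w u)) (cong (f w * 𝟙 (X w) +_) (*-comm (f w) (δ w u))))

  load-insert : ∀ {X u} → X u ≡ false → ∀ v → load (insert X u) v ≡ load X v + C v u
  load-insert Xu≡false v = sum-insert Xu≡false (C v)

  size-insert : ∀ {X u} → X u ≡ false → size (insert X u) ≡ suc (size X)
  size-insert {X} {u} Xu≡false = begin
    size (insert X u)                   ≡⟨ sum-cong-≗ (λ w → sym (*-identityˡ (𝟙 (insert X u w)))) ⟩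
    sum (λ w → 1 * 𝟙 (insert X u w))    ≡⟨ sum-insert Xu≡false (λ _ → 1) ⟩
    sum (λ w → 1 * 𝟙 (X w)) + 1         ≡⟨ cong (_+ 1) (sum-cong-≗ (λ w → *-identityˡ (𝟙 (X w)))) ⟩
    size X + 1                          ≡⟨ +-comm (size X) 1 ⟩
    suc (size X)                        ∎
    where open ≡-Reasoning

  greedy : ∀ k fuel X → Packing k X → n ≤ size X + fuel → ∃[ Y ] Packing k Y × Maximal k Y
  greedy k fuel X pk n≤ with any? (λ u → (X u Bool.≟ false) ×-dec packing? k (insert X u))
  ... | no stuck = X , pk , λ u Xu≡false pk′ → stuck (u , Xu≡false , pk′)
  greedy k zero X pk n≤ | yes (u , Xu≡false , _) =
    contradiction (≤-trans (subst (_≤ n) (size-insert Xu≡false) (size≤n (insert X u)))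
                           (subst (n ≤_) (+-identityʳ (size X)) n≤))
                  1+n≰n
  greedy k (suc fuel) X pk n≤ | yes (u , Xu≡false , pk′) =
    greedy k fuel (insert X u) pk′
      (subst (n ≤_) (trans (+-suc (size X) fuel) (cong (_+ fuel) (sym (size-insert Xu≡false)))) n≤)

  maximal-packing : ∀ k → ∃[ X ] Packing k X × Maximal k X
  maximal-packing k = greedy k n (λ _ → false) empty (m≤n+m n _)
    where
    empty : Packing k (λ _ → false)
    empty v = subst (_≤ k) (sym (trans (sum-cong-≗ (λ u → *-zeroʳ (C v u))) (sum-replicate-zero n))) z≤n

  saturated-cover : ∀ {k X} → Packing k X → Maximal k X →
    ∀ u → X u ≡ false → ∃[ v ] C v u ≡ 1 × load X v ≡ k
  saturated-cover {k} {X} pk maximal u Xu≡false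
    with ¬∀⟶∃¬ n _ (λ v → load (insert X u) v ≤? k) (maximal u Xu≡false)
  ... | v , overloaded =
    v , overflow (C v u) (C≤1 v u) (pk v) (overloaded ∘ subst (_≤ k) (sym (load-insert Xu≡false v)))

  module Discharging (D : ℕ) (regular : Regular G (2 + D)) (X : Fin n → Bool)
    (cover : ∀ u → X u ≡ false → ∃[ v ] C v u ≡ 1 × load X v ≡ 2) where

    Δ : ℕ
    Δ = 2 + D

    inX outX : Fin n → ℕ
    inX u  = 𝟙 (X u)
    outX u = 𝟙 (not (X u))

    sat : Fin n → ℕ
    sat v = 𝟙 ⌊ load X v ℕ.≟ 2 ⌋

    sat≡1 : ∀ v → load X v ≡ 2 → sat v ≡ 1
    sat≡1 v saturated with load X v ℕ.≟ 2
    ... | yes _   = refl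
    ... | no  ¬sat = contradiction saturated ¬sat

    saturated-weight : ∀ a v {m k} → (load X v ≡ 2 → m ≤ k) → a * sat v * m ≤ a * k
    saturated-weight a v {m} {k} m≤k = ≤-trans (≤-reflexive (*-assoc a (sat v) m)) (*-monoʳ-≤ a guarded)
      where
      guarded : sat v * m ≤ k
      guarded with load X v ℕ.≟ 2
      ... | yes saturated = subst (_≤ k) (sym (+-identityʳ m)) (m≤k saturated)
      ... | no  _         = z≤n

    degree≡Δ : ∀ v → sum (A v) ≡ Δ
    degree≡Δ v = trans (sym (∣tabulate∣≡sum (adj G v))) (regular v)

    outside+load : ∀ v → sum (λ u → C v u * outX u) + load X v ≡ suc Δ
    outside+load v = begin
      sum (λ u → C v u * outX u) + load X v       ≡⟨ ∑-distrib-+ (λ u → C v u * outX u) (λ u → C v u * inX u) ⟨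
      sum (λ u → C v u * outX u + C v u * inX u)  ≡⟨ sum-cong-≗ (λ u → trans (sym (*-distribˡ-+ (C v u) (outX u) (inX u)))
                                                       (cong (C v u *_) (trans (+-comm (outX u) (inX u)) (𝟙+𝟙-not (X u))))) ⟩
      sum (λ u → C v u * 1)                       ≡⟨ sum-C v (λ _ → 1) ⟩
      suc (sum (λ u → A v u * 1))                 ≡⟨ cong suc (trans (sum-cong-≗ (λ u → *-identityʳ (A v u))) (degree≡Δ v)) ⟩
      suc Δ                                       ∎
      where open ≡-Reasoning

    outside-saturated : ∀ v → load X v ≡ 2 → sum (λ u → C v u * outX u) ≡ suc D
    outside-saturated v saturated = +-cancelʳ-≡ 2 _ (suc D)
      (trans (cong (sum (λ u → C v u * outX u) +_) (sym saturated)) (trans (outside+load v) (+-comm 2 (suc D))))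

    outside-neighbours : ∀ v → load X v ≡ 2 → sum (λ u → A v u * outX u) ≡ D + inX v
    outside-neighbours v saturated =
      cancel (X v) _ (trans (sym (sum-C v outX)) (outside-saturated v saturated))
      where
      cancel : ∀ b q → 𝟙 (not b) + q ≡ suc D → q ≡ D + 𝟙 b
      cancel true  q q≡1+D  = trans q≡1+D (+-comm 1 D)
      cancel false q 1+q≡1+D = trans (suc-injective 1+q≡1+D) (sym (+-identityʳ D))

    neighbours-in-X : ∀ x → X x ≡ true → load X x ≡ 2 → sum (λ v → A x v * inX v) ≡ 1
    neighbours-in-X x x∈X saturated =
      suc-injective (trans (cong (_+ sum (λ v → A x v * inX v)) (cong 𝟙 (sym x∈X))) (trans (sym (sum-C x inX)) saturated))

    charge : Fin n → Fin n → ℕ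
    charge x u with load X x ℕ.≟ 2
    ... | yes _ = C x u + sum (λ v → A x v * sat v * A v u)
    ... | no  _ = sum (λ v → A x v * sat v * C v u)

    saturated-term : ∀ {a v c} → a ≡ 1 → load X v ≡ 2 → c ≡ 1 → a * sat v * c ≡ 1
    saturated-term {v = v} refl saturated refl rewrite sat≡1 v saturated = refl

    charge-self : ∀ {x u} → load X x ≡ 2 → C x u ≡ 1 → 1 ≤ charge x u
    charge-self {x} {u} saturated Cxu≡1 with load X x ℕ.≟ 2
    ... | yes _    = ≤-trans (≤-reflexive (sym Cxu≡1)) (m≤m+n (C x u) _)
    ... | no  ¬sat = contradiction saturated ¬sat

    charge-via-neighbour : ∀ {v x u} → A x v ≡ 1 → load X v ≡ 2 → C v u ≡ 1 → 1 ≤ charge x u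
    charge-via-neighbour {v} {x} {u} Axv≡1 saturated Cvu≡1 with load X x ℕ.≟ 2 | C≡1⇒≡⊎A≡1 Cvu≡1
    ... | no  _ | _          = ≤-trans (≤-reflexive (sym (saturated-term Axv≡1 saturated Cvu≡1)))
                                 (term≤sum (λ w → A x w * sat w * C w u) v)
    ... | yes _ | inj₁ refl  = ≤-trans (subst (_≤ C x u) Axv≡1 (A≤C x u)) (m≤m+n (C x u) _)
    ... | yes _ | inj₂ Avu≡1 = ≤-trans (≤-trans (≤-reflexive (sym (saturated-term Axv≡1 saturated Avu≡1)))
                                          (term≤sum (λ w → A x w * sat w * A w u) v))
                                 (m≤n+m _ (C x u))

    charge-positive : ∀ {v x u} → C v x ≡ 1 → C v u ≡ 1 → load X v ≡ 2 → 1 ≤ charge x u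
    charge-positive {v} {x} Cvx≡1 Cvu≡1 saturated with C≡1⇒≡⊎A≡1 Cvx≡1
    ... | inj₁ refl  = charge-self saturated Cvu≡1
    ... | inj₂ Avx≡1 = charge-via-neighbour (trans (A-sym x v) Avx≡1) saturated Cvu≡1

    charge-received : ∀ u → X u ≡ false → 2 ≤ sum (λ x → inX x * charge x u)
    charge-received u u∉X with cover u u∉X
    ... | v , Cvu≡1 , saturated = subst (_≤ _) saturated (sum-mono-≤ pays)
      where
      pays : ∀ x → C v x * inX x ≤ inX x * charge x u
      pays x with X x
      ... | false = ≤-reflexive (*-zeroʳ (C v x))
      ... | true  = subst₂ _≤_ (sym (*-identityʳ (C v x))) (sym (+-identityʳ _))
                      (≤1⇒≤ (C≤1 v x) (λ Cvx≡1 → charge-positive Cvx≡1 Cvu≡1 saturated))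

    M : ℕ
    M = Δ * suc D

    charge-sent : ∀ x → X x ≡ true → sum (λ u → charge x u * outX u) ≤ M
    charge-sent x x∈X with load X x ℕ.≟ 2
    ... | no _ = begin
      sum (λ u → sum (λ v → A x v * sat v * C v u) * outX u)  ≡⟨ ∑-*-comm (λ v → A x v * sat v) C outX ⟩
      sum (λ v → A x v * sat v * sum (λ u → C v u * outX u))  ≤⟨ sum-mono-≤ (λ v → saturated-weight (A x v) v
                                                                  (≤-reflexive ∘ outside-saturated v)) ⟩
      sum (λ v → A x v * suc D)                               ≡⟨ *-distribʳ-sum (suc D) (A x) ⟨
      sum (A x) * suc D                                       ≡⟨ cong (_* suc D) (degree≡Δ x) ⟩
      M                                                       ∎
      where open ≤-Reasoning
    ... | yes saturated = begin
      sum (λ u → (C x u + sum (λ v → A x v * sat v * A v u)) * outX u)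
        ≡⟨ sum-cong-≗ (λ u → *-distribʳ-+ (outX u) (C x u) _) ⟩
      sum (λ u → C x u * outX u + sum (λ v → A x v * sat v * A v u) * outX u)
        ≡⟨ ∑-distrib-+ (λ u → C x u * outX u) (λ u → sum (λ v → A x v * sat v * A v u) * outX u) ⟩
      sum (λ u → C x u * outX u) + sum (λ u → sum (λ v → A x v * sat v * A v u) * outX u)
        ≡⟨ cong₂ _+_ (outside-saturated x saturated) (∑-*-comm (λ v → A x v * sat v) A outX) ⟩
      suc D + sum (λ v → A x v * sat v * sum (λ u → A v u * outX u))
        ≤⟨ +-monoʳ-≤ (suc D) (sum-mono-≤ (λ v → saturated-weight (A x v) v (≤-reflexive ∘ outside-neighbours v))) ⟩
      suc D + sum (λ v → A x v * (D + inX v))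
        ≡⟨ cong (suc D +_) (trans (sum-cong-≗ (λ v → *-distribˡ-+ (A x v) D (inX v))) (∑-distrib-+ (λ v → A x v * D) (λ v → A x v * inX v))) ⟩
      suc D + (sum (λ v → A x v * D) + sum (λ v → A x v * inX v))
        ≡⟨ cong (suc D +_) (cong₂ _+_ (trans (sym (*-distribʳ-sum D (A x))) (cong (_* D) (degree≡Δ x)))
                                      (neighbours-in-X x x∈X saturated)) ⟩
      suc D + (Δ * D + 1)
        ≡⟨ arithmetic D ⟩
      M ∎
      where
      open ≤-Reasoning
      arithmetic : ∀ D → suc D + ((2 + D) * D + 1) ≡ (2 + D) * suc D
      arithmetic = solve-∀

    double-count : 2 * sum outX ≤ size X * M
    double-count = begin
      2 * sum outX                                               ≡⟨ *-distribˡ-sum 2 outX ⟩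
      sum (λ u → 2 * outX u)                                     ≤⟨ sum-mono-≤ received ⟩
      sum (λ u → sum (λ x → inX x * charge x u) * outX u)        ≡⟨ ∑-*-comm inX charge outX ⟩
      sum (λ x → inX x * sum (λ u → charge x u * outX u))        ≤⟨ sum-mono-≤ sent ⟩
      sum (λ x → inX x * M)                                      ≡⟨ *-distribʳ-sum M inX ⟨
      size X * M                                                 ∎
      where
      open ≤-Reasoning
      received : ∀ u → 2 * outX u ≤ sum (λ x → inX x * charge x u) * outX u
      received u with X u in eq
      ... | true  = z≤n
      ... | false = subst (2 ≤_) (sym (*-identityʳ _)) (charge-received u eq)
      sent : ∀ x → inX x * sum (λ u → charge x u * outX u) ≤ inX x * M
      sent x with X x in eq
      ... | true  = *-monoʳ-≤ 1 (charge-sent x eq)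
      ... | false = z≤n

    packing-bound : 2 * n ≤ size X * (M + 2)
    packing-bound = begin
      2 * n                           ≡⟨ cong (2 *_) size+outside ⟨
      2 * (size X + sum outX)         ≡⟨ *-distribˡ-+ 2 (size X) (sum outX) ⟩
      2 * size X + 2 * sum outX       ≤⟨ +-monoʳ-≤ (2 * size X) double-count ⟩
      2 * size X + size X * M         ≡⟨ cong (_+ size X * M) (*-comm 2 (size X)) ⟩
      size X * 2 + size X * M         ≡⟨ *-distribˡ-+ (size X) 2 M ⟨
      size X * (2 + M)                ≡⟨ cong (size X *_) (+-comm 2 M) ⟩
      size X * (M + 2)                ∎
      where
      open ≤-Reasoning
      size+outside : size X + sum outX ≡ n
      size+outside = trans (sym (∑-distrib-+ inX outX))
                       (trans (sum-cong-≗ (𝟙+𝟙-not ∘ X)) (sum-const-1 n))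

m*m∸m≡m*[m∸1] : ∀ m → m * m ∸ m ≡ m * (m ∸ 1)
m*m∸m≡m*[m∸1] m = trans (cong (m * m ∸_) (sym (*-identityʳ m))) (sym (*-distribˡ-∸ m m 1))

theorem4 : ∀ (n Δ : ℕ) (G : Graph n) → 3 ≤ Δ → Regular G Δ →
    Σ (Subset n) (λ X → IsLimitedPacking 2 G X × 2 * n ≤ ∣ X ∣ * (Δ * Δ ∸ Δ + 2))
theorem4 n (suc (suc D)) G (s≤s (s≤s _)) regular with maximal-packing G 2
... | X , packing , maximal = tabulate X , limited , bound
  where
  open Discharging G D regular X (saturated-cover G packing maximal)
  limited : IsLimitedPacking 2 G (tabulate X)
  limited v = subst (_≤ 2) (sym (∣N[v]∩X∣≡load G X v)) (packing v)
  bound : 2 * n ≤ ∣ tabulate X ∣ * (suc (suc D) * suc (suc D) ∸ suc (suc D) + 2)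
  bound rewrite ∣tabulate∣≡sum X | m*m∸m≡m*[m∸1] (suc (suc D)) = packing-bound
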